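{- Let $\mathcal{K}=(Q,\delta,\lambda)$ be a Kripke structure and $(S^+,S^-)$ a sample of $\mathcal{K}$. Then the separating formula $\mathcal{S}_\mathcal{K}(S^+,S^-)=\bigvee_{q^+\in S^+}\bigwedge_{q^-\in S^- }D_{q^+,q^- }$ is well defined and consistent with $(S^+,S^-)$, i.e. $q^+\models_\mathcal{K}\mathcal{S}_\mathcal{K}(S^+,S^-)$ for all $q^+\in S^+$ and $q^-\not\models_\mathcal{K}\mathcal{S}_\mathcal{K}(S^+,S^-)$ for all $q^-\in S^-$.
   Context: A Kripke structure is $\mathcal{K}=(Q,\delta,\lambda)$ with $Q$ finite, $\delta:Q\to2^Q\setminus\{\emptyset\}$, $\lambda:Q\to2^{\mathsf{AP}}$ for a finite set $\mathsf{AP}$; both $\mathsf{AP}$ and $Q$ are assumed totally ordered. Define equivalences $\sim_i$ on $Q$: $q_1\sim_0q_2$ iff $\lambda(q_1)=\lambda(q_2)$; $q_1\sim_{i+1}q_2$ iff $q_1\sim_iq_2$ and $\{[q_1']_{\sim_i}\mid q_1'\in\delta(q_1)\}=\{[q_2']_{\sim_i}\mid q_2'\in\delta(q_2)\}$. The bisimulation $\sim$ is the coarsest equivalence such that $q_1\sim q_2$ implies $\lambda(q_1)=\lambda(q_2)$ and every successor of $q_1$ is $\sim$-related to some successor of $q_2$; it equals $\sim_i$ for all large enough $i$. A sample is a pair $(S^+,S^-)$ of subsets of $Q$ with $q^+\not\sim q^-$ for all $q^+\in S^+,q^-\in S^-$. For sets $A,B\subseteq Q$ with no element of $A$ bisimilar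 to an element of $B$, $\mathcal{C}_\mathcal{K}(A,B)$ is the smallest $c\in\mathbb{N}$ with $a\not\sim_c b$ for all $a\in A,b\in B$. For $q_1\not\sim q_2$, with $c=\mathcal{C}_\mathcal{K}(\{q_1\},\{q_2\})$, the formula $D_{q_1,q_2}$ is defined inductively on $c$: if $c=0$ and $\lambda(q_1)\setminus\lambda(q_2)\neq\emptyset$ with minimal element $a$, $D_{q_1,q_2}=a$; else if $c=0$ and $\lambda(q_2)\setminus\lambda(q_1)\ne\emptyset$ with minimal element $a$, $D_{q_1,q_2}=\neg a$; else if $c\neq0$ and there is $q_1'\in\delta(q_1)$ with $q_1'\not\sim_{c-1}q_2'$ for all $q_2'\in\delta(q_2)$, then, taking the smallest such $q_1'$, $D_{q_1,q_2}=\exists\mathsf{X}\bigl(\bigwedge_{q_2'\in\delta(q_2)}D_{q_1',q_2'}\bigr)$; else if $c\ne0$ and there is $q_2'\in\delta(q_2)$ with $q_1'\not\sim_{c-1}q_2'$ for all $q_1'\in\delta(q_1)$, then, taking the smallest such $q_2'$, $D_{q_1,q_2}=\forall\mathsf{X}\,\neg\bigl(\bigwedge_{q_1'\in\delta(q_1)}D_{q_2',q_1'}\bigr)$. Here $\exists\mathsf{X}\varphi$ holds at $q$ iff some successor satisfies $\varphi$, and $\forall\mathsf{X}\varphi$ iff all successors satisfy $\varphi$. A formula $\varphi$ is consistent with $(S^+,S^-)$ if it holds at every state of $S^+$ and at no state of $S^-$. -}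

module Defs where

open import Data.Nat as ℕ using (ℕ; zero; suc)
open import Data.Fin as Fin using (Fin)
open import Data.Fin.Subset using (Subset; _∈_; _∉_; Nonempty)
open import Data.Fin.Subset.Properties using (_∈?_)
open import Data.List using (List; []; _∷_; foldr; map; filter)
open import Data.List.Base using (allFin)
open import Data.Product using (Σ; _×_; _,_; ∃)
open import Data.Empty using (⊥)
open import Data.Sum using (_⊎_)
open import Data.Unit using (⊤)
open import Relation.Nullary using (¬_)
open import Relation.Binary.PropositionalEquality using (_≡_)

-- Kripke structures: Q = Fin n, AP = Fin m (both totally ordered by
-- the order on Fin); δ q is a non-empty subset of Q, λ q a subset of AP.

record Kripke (n m : ℕ) : Set where
  field
    δ        : Fin n → Subset n
    δ-nonempty : ∀ q → Nonempty (δ q)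
    lab      : Fin n → Subset m
open Kripke public

elems : ∀ {n} → Subset n → List (Fin n)
elems {n} p = filter (_∈? p) (allFin n)

data Formula (m : ℕ) : Set where
  tt  : Formula m
  ff  : Formula m
  atom : Fin m → Formula m
  ¬ᶠ_ : Formula m → Formula m
  _∧ᶠ_ : Formula m → Formula m → Formula m
  _∨ᶠ_ : Formula m → Formula m → Formula m
  EX  : Formula m → Formula m
  AX  : Formula m → Formula m

⋀ : ∀ {m} → List (Formula m) → Formula m
⋀ = foldr _∧ᶠ_ tt

⋁ : ∀ {m} → List (Formula m) → Formula m
⋁ = foldr _∨ᶠ_ ff

_,_⊨_ : ∀ {n m} → Kripke n m → Fin n → Formula m → Set
K , q ⊨ tt = ⊤
K , q ⊨ ff = ⊥
K , q ⊨ atom a = a ∈ lab K q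
K , q ⊨ (¬ᶠ φ) = ¬ (K , q ⊨ φ)
K , q ⊨ (φ ∧ᶠ ψ) = (K , q ⊨ φ) × (K , q ⊨ ψ)
K , q ⊨ (φ ∨ᶠ ψ) = (K , q ⊨ φ) ⊎ (K , q ⊨ ψ)
K , q ⊨ EX φ = Σ (Fin _) λ q' → q' ∈ δ K q × (K , q' ⊨ φ)
K , q ⊨ AX φ = ∀ q' → q' ∈ δ K q → K , q' ⊨ φ

-- The approximants ∼_i.  q₁ ∼_{i+1} q₂ iff q₁ ∼_i q₂ and the sets of
-- ∼_i-classes of successors coincide (written out as forth/back).

Sim : ∀ {n m} → Kripke n m → ℕ → Fin n → Fin n → Set
Sim K zero q₁ q₂ = lab K q₁ ≡ lab K q₂
Sim K (suc i) q₁ q₂ =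
  Sim K i q₁ q₂ ×
  (∀ q₁' → q₁' ∈ δ K q₁ → Σ (Fin _) λ q₂' → q₂' ∈ δ K q₂ × Sim K i q₁' q₂') ×
  (∀ q₂' → q₂' ∈ δ K q₂ → Σ (Fin _) λ q₁' → q₁' ∈ δ K q₁ × Sim K i q₁' q₂')

IsBisimulation : ∀ {n m} → Kripke n m → (Fin n → Fin n → Set) → Set
IsBisimulation K R = ∀ q₁ q₂ → R q₁ q₂ →
  (lab K q₁ ≡ lab K q₂) ×
  (∀ q₁' → q₁' ∈ δ K q₁ → Σ (Fin _) λ q₂' → q₂' ∈ δ K q₂ × R q₁' q₂') ×
  (∀ q₂' → q₂' ∈ δ K q₂ → Σ (Fin _) λ q₁' → q₁' ∈ δ K q₁ × R q₁' q₂')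

Bisimilar : ∀ {n m} → Kripke n m → Fin n → Fin n → Set₁
Bisimilar K q₁ q₂ = Σ (Fin _ → Fin _ → Set) λ R → IsBisimulation K R × R q₁ q₂

IsSample : ∀ {n m} → Kripke n m → Subset n → Subset n → Set₁
IsSample K S⁺ S⁻ = ∀ q⁺ q⁻ → q⁺ ∈ S⁺ → q⁻ ∈ S⁻ → ¬ Bisimilar K q⁺ q⁻

IsC : ∀ {n m} → Kripke n m → Fin n → Fin n → ℕ → Set
IsC K q₁ q₂ c = ¬ Sim K c q₁ q₂ × (∀ c' → c' ℕ.< c → Sim K c' q₁ q₂)

-- The distinguishing formula D_{q₁,q₂}, as the (inductive) graph of the
-- paper's case definition.  IsD K q₁ q₂ φ means "D_{q₁,q₂} = φ".

data IsD {n m} (K : Kripke n m) : Fin n → Fin n → Formula m → Set where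
  d-pos : ∀ {q₁ q₂} (a : Fin m) →
    IsC K q₁ q₂ 0 →
    a ∈ lab K q₁ → a ∉ lab K q₂ →
    (∀ b → b Fin.< a → b ∈ lab K q₁ → b ∈ lab K q₂) →
    IsD K q₁ q₂ (atom a)
  d-neg : ∀ {q₁ q₂} (a : Fin m) →
    IsC K q₁ q₂ 0 →
    (∀ b → b ∈ lab K q₁ → b ∈ lab K q₂) →
    a ∈ lab K q₂ → a ∉ lab K q₁ →
    (∀ b → b Fin.< a → b ∈ lab K q₂ → b ∈ lab K q₁) →
    IsD K q₁ q₂ (¬ᶠ atom a)
  d-ex : ∀ {q₁ q₂} (c' : ℕ) (q₁' : Fin n) (f : Fin n → Formula m) →
    IsC K q₁ q₂ (suc c') →
    q₁' ∈ δ K q₁ →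
    (∀ q₂' → q₂' ∈ δ K q₂ → ¬ Sim K c' q₁' q₂') →
    (∀ r → r Fin.< q₁' → r ∈ δ K q₁ →
       Σ (Fin n) λ q₂' → q₂' ∈ δ K q₂ × Sim K c' r q₂') →
    (∀ q₂' → q₂' ∈ δ K q₂ → IsD K q₁' q₂' (f q₂')) →
    IsD K q₁ q₂ (EX (⋀ (map f (elems (δ K q₂)))))
  d-ax : ∀ {q₁ q₂} (c' : ℕ) (q₂' : Fin n) (f : Fin n → Formula m) →
    IsC K q₁ q₂ (suc c') →
    (∀ q₁' → q₁' ∈ δ K q₁ →
       Σ (Fin n) λ r → r ∈ δ K q₂ × Sim K c' q₁' r) →
    q₂' ∈ δ K q₂ →
    (∀ q₁' → q₁' ∈ δ K q₁ → ¬ Sim K c' q₁' q₂') →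
    (∀ r → r Fin.< q₂' → r ∈ δ K q₂ →
       Σ (Fin n) λ q₁' → q₁' ∈ δ K q₁ × Sim K c' q₁' r) →
    (∀ q₁' → q₁' ∈ δ K q₁ → IsD K q₂' q₁' (f q₁')) →
    IsD K q₁ q₂ (AX (¬ᶠ ⋀ (map f (elems (δ K q₁)))))

SepFormula : ∀ {n m} → (Fin n → Fin n → Formula m) → Subset n → Subset n → Formula m
SepFormula D S⁺ S⁻ = ⋁ (map (λ p → ⋀ (map (λ q → D p q) (elems S⁻))) (elems S⁺))

Consistent : ∀ {n m} → Kripke n m → Formula m → Subset n → Subset n → Set
Consistent K φ S⁺ S⁻ =
  (∀ q → q ∈ S⁺ → K , q ⊨ φ) × (∀ q → q ∈ S⁻ → ¬ (K , q ⊨ φ))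

{-# OPTIONS --safe #-}
-- The approximants ∼ᵢ form a descending chain of decidable relations on a finite
-- set, so some ∼ₖ is contained in ∼ₖ₊₁ and is then a bisimulation: states of a
-- sample are already ∼ₖ-inequivalent, and D_{q⁺,q⁻} is built by recursion on k.
-- Every choice made by the construction is the least counterexample to some
-- inclusion, which makes D unique, and q₁ ⊨ D_{q₁,q₂}, q₂ ⊭ D_{q₁,q₂} by induction
-- on D.  Hence q⁺ satisfies its own disjunct of the separating formula, while
-- every disjunct contains a conjunct D_{q⁺,q⁻} refuted by q⁻.
module Submission where

open import Defs
open import Data.Nat using (ℕ)
open import Data.Fin using (Fin)
open import Data.Fin.Subset using (Subset; _∈_)
open import Data.Product using (Σ; _×_)
open import Relation.Binary.PropositionalEquality using (_≡_)

open import Data.Bool.Properties using (_≟_)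
open import Data.Empty using (⊥-elim)
open import Data.Fin as Fin using (inject; fromℕ<; combine; remQuot)
open import Data.Fin.Properties as Fin
  using (¬∀⟶∃¬-smallest; toℕ-inject; toℕ-fromℕ<; toℕ-injective; remQuot-combine; all?; any?)
open import Data.Fin.Subset using (_⊆_; ∣_∣)
open import Data.Fin.Subset.Properties using (_∈?_; _⊂?_; ⊆-antisym; p⊂q⇒∣p∣<∣q∣)
open import Data.List using ([]; _∷_; map; allFin)
open import Data.List.Membership.Propositional using (find; lose) renaming (_∈_ to _∈ₗ_)
open import Data.List.Membership.Propositional.Properties using (∈-filter⁺; ∈-filter⁻; ∈-allFin)
open import Data.List.Properties using (map-cong-local)
open import Data.List.Relation.Unary.All as All using (All; []; _∷_)
import Data.List.Relation.Unary.All.Properties as All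
open import Data.List.Relation.Unary.Any using (Any; here; there)
import Data.List.Relation.Unary.Any.Properties as Any
open import Data.Nat as ℕ using (zero; suc; _≤′_; ≤′-refl; ≤′-step; z≤n)
open import Data.Nat.Properties as ℕ
  using (≤⇒≤′; ≤-refl; ≤-pred; <-≤-trans; n<1+n; 0≢1+n; suc-injective)
open import Data.Product using (_,_; proj₁; proj₂; ∃; ∃-syntax; curry; uncurry)
open import Data.Sum using (_⊎_; inj₁; inj₂)
open import Data.Unit using (tt)
open import Data.Vec using (tabulate)
open import Data.Vec.Properties using (lookup⇒[]=; []=⇒lookup; lookup∘tabulate; ≡-dec)
open import Function using (_∘_; flip)
open import Relation.Binary using (tri<; tri≈; tri>) renaming (Decidable to Decidable₂)
open import Relation.Binary.PropositionalEquality using (refl; sym; trans; cong; subst)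
open import Relation.Nullary using (¬_; yes; no; does)
open import Relation.Nullary.Decidable using (_×-dec_; _→-dec_; dec-true; decidable-stable)
open import Relation.Unary using (Decidable)

module _ {k : ℕ} where

  IsLeastCounterexample : (A B : Fin k → Set) → Fin k → Set
  IsLeastCounterexample A B a = A a × ¬ B a × (∀ b → b Fin.< a → A b → B b)

  inject-fromℕ< : ∀ {a b : Fin k} (b<a : b Fin.< a) → inject (fromℕ< b<a) ≡ b
  inject-fromℕ< b<a = toℕ-injective (trans (toℕ-inject _) (toℕ-fromℕ< b<a))

  least-counterexample : ∀ {A B : Fin k → Set} → Decidable A → Decidable B →
    (∀ x → A x → B x) ⊎ ∃ (IsLeastCounterexample A B)
  least-counterexample {A} {B} A? B? with all? (λ x → A? x →-dec B? x)
  ... | yes A⊆B = inj₁ A⊆B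
  ... | no A⊈B =
    let (a , A⇏B , below) = ¬∀⟶∃¬-smallest _ _ (λ x → A? x →-dec B? x) A⊈B
    in inj₂ ( a
            , decidable-stable (A? a) (λ ¬Aa → A⇏B (⊥-elim ∘ ¬Aa))
            , (λ Ba → A⇏B (λ _ → Ba))
            , λ b b<a → subst (λ x → A x → B x) (inject-fromℕ< b<a) (below (fromℕ< b<a)))

  least-counterexample-unique : ∀ {A B : Fin k → Set} {a a′} →
    IsLeastCounterexample A B a → IsLeastCounterexample A B a′ → a ≡ a′
  least-counterexample-unique {a = a} {a′} (Aa , ¬Ba , below) (Aa′ , ¬Ba′ , below′)
    with Fin.<-cmp a a′
  ... | tri< a<a′ _ _ = ⊥-elim (¬Ba (below′ a a<a′ Aa))
  ... | tri≈ _ a≡a′ _ = a≡a′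
  ... | tri> _ _ a′<a = ⊥-elim (¬Ba′ (below a′ a′<a Aa′))

decidable-choice : ∀ {A B : Set} {P : A → Set} {R : A → B → Set} → B → Decidable P →
  (∀ a → P a → Σ B (R a)) → Σ (A → B) λ f → ∀ a → P a → R a (f a)
decidable-choice {A} {B} {P} {R} default P? choose = f , f-spec
  where
  f : A → B
  f a with P? a
  ... | yes Pa = proj₁ (choose a Pa)
  ... | no _ = default
  f-spec : ∀ a → P a → R a (f a)
  f-spec a Pa with P? a
  ... | yes Pa′ = proj₂ (choose a Pa′)
  ... | no ¬Pa = ⊥-elim (¬Pa Pa)

module _ {N : ℕ} where

  subsetOf : ∀ {P : Fin N → Set} → Decidable P → Subset N
  subsetOf P? = tabulate (does ∘ P?)

  ∈-subsetOf⁺ : ∀ {P : Fin N → Set} {P? : Decidable P} {x} → P x → x ∈ subsetOf P?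
  ∈-subsetOf⁺ {P? = P?} {x} Px =
    lookup⇒[]= x _ (trans (lookup∘tabulate _ x) (dec-true (P? x) Px))

  ∈-subsetOf⁻ : ∀ {P : Fin N → Set} {P? : Decidable P} {x} → x ∈ subsetOf P? → P x
  ∈-subsetOf⁻ {P? = P?} {x} x∈ with P? x | trans (sym (lookup∘tabulate _ x)) ([]=⇒lookup x∈)
  ... | yes Px | _ = Px
  ... | no _ | ()

  ⊆-descending-stabilises : (P : ℕ → Subset N) → (∀ k → P (suc k) ⊆ P k) →
    ∃[ k ] P k ⊆ P (suc k)
  ⊆-descending-stabilises P descending = go ∣ P 0 ∣ 0 ≤-refl
    where
    go : ∀ b k → ∣ P k ∣ ℕ.≤ b → ∃[ k ] P k ⊆ P (suc k)
    go b k ∣Pk∣≤b with P (suc k) ⊂? P k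
    ... | no ⊄ = k , λ {x} x∈ →
      decidable-stable (x ∈? P (suc k)) (λ x∉ → ⊄ (descending k , x , x∈ , x∉))
    ... | yes ⊂ with b | <-≤-trans (p⊂q⇒∣p∣<∣q∣ ⊂) ∣Pk∣≤b
    ...   | zero | ()
    ...   | suc b′ | ∣Psk∣<b = go b′ (suc k) (≤-pred ∣Psk∣<b)

-- Relations on Fin n are coded as subsets of Fin (n * n) via combine/remQuot.
descending-relations-stabilise : ∀ {n} (R : ℕ → Fin n → Fin n → Set) →
  (∀ k → Decidable₂ (R k)) → (∀ k {x y} → R (suc k) x y → R k x y) →
  ∃[ k ] (∀ {x y} → R k x y → R (suc k) x y)
descending-relations-stabilise {n} R R? descending =
  let (k , stable) = ⊆-descending-stabilises related related-descending
  in k , λ Rxy → fromPair (stable (toPair Rxy))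
  where
  Related : ℕ → Fin (n ℕ.* n) → Set
  Related k = uncurry (R k) ∘ remQuot {n} n
  Related? : ∀ k → Decidable (Related k)
  Related? k i = R? k (proj₁ (remQuot {n} n i)) (proj₂ (remQuot {n} n i))
  related : ℕ → Subset (n ℕ.* n)
  related k = subsetOf (Related? k)
  related-descending : ∀ k → related (suc k) ⊆ related k
  related-descending k =
    ∈-subsetOf⁺ {P? = Related? k} ∘ descending k ∘ ∈-subsetOf⁻ {P? = Related? (suc k)}
  toPair : ∀ {k x y} → R k x y → combine x y ∈ related k
  toPair {k} {x} {y} Rxy =
    ∈-subsetOf⁺ {P? = Related? k} (subst (uncurry (R k)) (sym (remQuot-combine x y)) Rxy)
  fromPair : ∀ {k x y} → combine x y ∈ related k → R k x y
  fromPair {k} {x} {y} =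
    subst (uncurry (R k)) (remQuot-combine x y) ∘ ∈-subsetOf⁻ {P? = Related? k}

module _ {n : ℕ} {S : Subset n} where

  ∈-elems⁺ : ∀ {q} → q ∈ S → q ∈ₗ elems S
  ∈-elems⁺ {q} q∈S = ∈-filter⁺ (_∈? S) (∈-allFin q) q∈S

  ∈-elems⁻ : ∀ {q} → q ∈ₗ elems S → q ∈ S
  ∈-elems⁻ = proj₂ ∘ ∈-filter⁻ (_∈? S) {xs = allFin n}

  map-elems-cong : ∀ {A : Set} {f g : Fin n → A} → (∀ q → q ∈ S → f q ≡ g q) →
    map f (elems S) ≡ map g (elems S)
  map-elems-cong f≗g = map-cong-local (All.tabulate (f≗g _ ∘ ∈-elems⁻))

module _ {n m : ℕ} (K : Kripke n m) where

  ⊨-⋀⁺ : ∀ {x φs} → All (λ φ → K , x ⊨ φ) φs → K , x ⊨ ⋀ φs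
  ⊨-⋀⁺ [] = tt
  ⊨-⋀⁺ (sat ∷ sats) = sat , ⊨-⋀⁺ sats

  ⊨-⋀⁻ : ∀ {x} φs → K , x ⊨ ⋀ φs → All (λ φ → K , x ⊨ φ) φs
  ⊨-⋀⁻ [] _ = []
  ⊨-⋀⁻ (_ ∷ φs) (sat , sats) = sat ∷ ⊨-⋀⁻ φs sats

  ⊨-⋁⁺ : ∀ {x φs} → Any (λ φ → K , x ⊨ φ) φs → K , x ⊨ ⋁ φs
  ⊨-⋁⁺ (here sat) = inj₁ sat
  ⊨-⋁⁺ (there sat) = inj₂ (⊨-⋁⁺ sat)

  ⊨-⋁⁻ : ∀ {x} φs → K , x ⊨ ⋁ φs → Any (λ φ → K , x ⊨ φ) φs
  ⊨-⋁⁻ (_ ∷ φs) (inj₁ sat) = here sat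
  ⊨-⋁⁻ (_ ∷ φs) (inj₂ sat) = there (⊨-⋁⁻ φs sat)

  module _ {x : Fin n} (f : Fin n → Formula m) {S : Subset n} where

    ⊨-⋀-elems⁺ : (∀ q → q ∈ S → K , x ⊨ f q) → K , x ⊨ ⋀ (map f (elems S))
    ⊨-⋀-elems⁺ sat = ⊨-⋀⁺ (All.map⁺ (All.tabulate (sat _ ∘ ∈-elems⁻)))

    ⊨-⋀-elems⁻ : K , x ⊨ ⋀ (map f (elems S)) → ∀ {q} → q ∈ S → K , x ⊨ f q
    ⊨-⋀-elems⁻ sat q∈S = All.lookup (All.map⁻ (⊨-⋀⁻ _ sat)) (∈-elems⁺ q∈S)

    ⊨-⋁-elems⁺ : ∀ {q} → q ∈ S → K , x ⊨ f q → K , x ⊨ ⋁ (map f (elems S))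
    ⊨-⋁-elems⁺ q∈S sat = ⊨-⋁⁺ (Any.map⁺ (lose (∈-elems⁺ q∈S) sat))

    ⊨-⋁-elems⁻ : K , x ⊨ ⋁ (map f (elems S)) → ∃ λ q → q ∈ S × K , x ⊨ f q
    ⊨-⋁-elems⁻ sat =
      let (q , q∈ , sat-q) = find (Any.map⁻ (⊨-⋁⁻ _ sat)) in q , ∈-elems⁻ q∈ , sat-q

  MatchedIn : (Fin n → Fin n → Set) → Fin n → Fin n → Set
  MatchedIn R q x = ∃ λ y → y ∈ δ K q × R x y

  MatchedIn? : ∀ {R} → Decidable₂ R → ∀ q → Decidable (MatchedIn R q)
  MatchedIn? R? q x = any? (λ y → (y ∈? δ K q) ×-dec R? x y)

  ¬MatchedIn⁺ : ∀ R {q x} → (∀ y → y ∈ δ K q → ¬ R x y) → ¬ MatchedIn R q x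
  ¬MatchedIn⁺ _ x≁ (y , y∈ , x∼y) = x≁ y y∈ x∼y

  ¬MatchedIn⁻ : ∀ R {q x} → ¬ MatchedIn R q x → ∀ y → y ∈ δ K q → ¬ R x y
  ¬MatchedIn⁻ _ unmatched y y∈ x∼y = unmatched (y , y∈ , x∼y)

  Sim? : ∀ k → Decidable₂ (Sim K k)
  Sim? zero x y = ≡-dec _≟_ (lab K x) (lab K y)
  Sim? (suc k) x y =
    Sim? k x y
    ×-dec all? (λ x′ → (x′ ∈? δ K x) →-dec MatchedIn? (Sim? k) y x′)
    ×-dec all? (λ y′ → (y′ ∈? δ K y) →-dec MatchedIn? (flip (Sim? k)) x y′)

  Sim-sym : ∀ k {x y} → Sim K k x y → Sim K k y x
  Sim-sym zero x∼y = sym x∼y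
  Sim-sym (suc k) (x∼y , forth , back) =
    Sim-sym k x∼y ,
    (λ y′ y′∈ → let (x′ , x′∈ , x′∼y′) = back y′ y′∈ in x′ , x′∈ , Sim-sym k x′∼y′) ,
    (λ x′ x′∈ → let (y′ , y′∈ , x′∼y′) = forth x′ x′∈ in y′ , y′∈ , Sim-sym k x′∼y′)

  Sim-antitone : ∀ {c k x y} → c ℕ.≤ k → Sim K k x y → Sim K c x y
  Sim-antitone = go ∘ ≤⇒≤′
    where
    go : ∀ {c k x y} → c ≤′ k → Sim K k x y → Sim K c x y
    go ≤′-refl x∼y = x∼y
    go (≤′-step c≤k) (x∼y , _) = go c≤k x∼y

  stable-Sim-isBisimulation : ∀ {k} → (∀ {x y} → Sim K k x y → Sim K (suc k) x y) →
    IsBisimulation K (Sim K k)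
  stable-Sim-isBisimulation stable x y x∼y = Sim-antitone z≤n x∼y , proj₂ (stable x∼y)

  Sim-eventually-Bisimilar : ∃[ k ] (∀ x y → Sim K k x y → Bisimilar K x y)
  Sim-eventually-Bisimilar =
    let (k , stable) = descending-relations-stabilise (Sim K) Sim? (λ _ → proj₁)
    in k , λ x y x∼y → Sim K k , stable-Sim-isBisimulation stable , x∼y

  IsC-unique : ∀ {x y c c′} → IsC K x y c → IsC K x y c′ → c ≡ c′
  IsC-unique {c = c} {c′} (x≁y , below) (x≁′y , below′) with ℕ.<-cmp c c′
  ... | tri< c<c′ _ _ = ⊥-elim (x≁y (below′ c c<c′))
  ... | tri≈ _ c≡c′ _ = c≡c′
  ... | tri> _ _ c′<c = ⊥-elim (x≁′y (below c′ c′<c))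

  IsC-zero : ∀ {x y} → ¬ Sim K 0 x y → IsC K x y 0
  IsC-zero x≁y = x≁y , λ _ ()

  IsC-suc : ∀ {k x y} → Sim K k x y → ¬ Sim K (suc k) x y → IsC K x y (suc k)
  IsC-suc x∼y x≁y = x≁y , λ c c<1+k → Sim-antitone (≤-pred c<1+k) x∼y

  Distinguishes : Formula m → Fin n → Fin n → Set
  Distinguishes φ q₁ q₂ = K , q₁ ⊨ φ × ¬ (K , q₂ ⊨ φ)

  IsD-sound : ∀ {q₁ q₂ φ} → IsD K q₁ q₂ φ → Distinguishes φ q₁ q₂
  IsD-sound (d-pos a _ a∈ a∉ _) = a∈ , a∉
  IsD-sound (d-neg a _ _ a∈ a∉ _) = a∉ , λ a∉′ → a∉′ a∈
  IsD-sound (d-ex _ a f _ a∈ _ _ D) =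
    (a , a∈ , ⊨-⋀-elems⁺ f (λ y y∈ → proj₁ (IsD-sound (D y y∈)))) ,
    λ (y , y∈ , sat) → proj₂ (IsD-sound (D y y∈)) (⊨-⋀-elems⁻ f sat y∈)
  IsD-sound (d-ax _ a f _ _ a∈ _ _ D) =
    (λ x x∈ sat → proj₂ (IsD-sound (D x x∈)) (⊨-⋀-elems⁻ f sat x∈)) ,
    λ all → all a a∈ (⊨-⋀-elems⁺ f (λ x x∈ → proj₁ (IsD-sound (D x x∈))))

  IsD-unique : ∀ {q₁ q₂ φ ψ} → IsD K q₁ q₂ φ → IsD K q₁ q₂ ψ → φ ≡ ψ
  IsD-unique (d-pos a _ a∈ a∉ below) (d-pos a′ _ a′∈ a′∉ below′) =
    cong atom (least-counterexample-unique (a∈ , a∉ , below)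
                                           (a′∈ , a′∉ , below′))
  IsD-unique (d-neg a _ _ a∈ a∉ below) (d-neg a′ _ _ a′∈ a′∉ below′) =
    cong (¬ᶠ_ ∘ atom) (least-counterexample-unique (a∈ , a∉ , below)
                                                   (a′∈ , a′∉ , below′))
  IsD-unique (d-pos a _ a∈ a∉ _) (d-neg _ _ λ₁⊆λ₂ _ _ _) = ⊥-elim (a∉ (λ₁⊆λ₂ a a∈))
  IsD-unique (d-neg _ _ λ₁⊆λ₂ _ _ _) (d-pos a _ a∈ a∉ _) = ⊥-elim (a∉ (λ₁⊆λ₂ a a∈))
  IsD-unique (d-ex c a f C a∈ a≁ below D) (d-ex c′ a′ f′ C′ a′∈ a′≁ below′ D′)
    with suc-injective (IsC-unique C C′)
  ... | refl with least-counterexample-unique (a∈ , ¬MatchedIn⁺ (Sim K c) a≁ , below)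
                                               (a′∈ , ¬MatchedIn⁺ (Sim K c) a′≁ , below′)
  ... | refl = cong (EX ∘ ⋀) (map-elems-cong (λ y y∈ → IsD-unique (D y y∈) (D′ y y∈)))
  IsD-unique (d-ax c a f C _ a∈ a≁ below D) (d-ax c′ a′ f′ C′ _ a′∈ a′≁ below′ D′)
    with suc-injective (IsC-unique C C′)
  ... | refl with least-counterexample-unique (a∈ , ¬MatchedIn⁺ (flip (Sim K c)) a≁ , below)
                                               (a′∈ , ¬MatchedIn⁺ (flip (Sim K c)) a′≁ , below′)
  ... | refl = cong (AX ∘ ¬ᶠ_ ∘ ⋀) (map-elems-cong (λ x x∈ → IsD-unique (D x x∈) (D′ x x∈)))
  IsD-unique (d-ex c a _ C a∈ a≁ _ _) (d-ax c′ _ _ C′ forth _ _ _ _)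
    with suc-injective (IsC-unique C C′)
  ... | refl = let (y , y∈ , a∼y) = forth a a∈ in ⊥-elim (a≁ y y∈ a∼y)
  IsD-unique (d-ax c _ _ C forth _ _ _ _) (d-ex c′ a _ C′ a∈ a≁ _ _)
    with suc-injective (IsC-unique C C′)
  ... | refl = let (y , y∈ , a∼y) = forth a a∈ in ⊥-elim (a≁ y y∈ a∼y)
  IsD-unique (d-pos _ C _ _ _) (d-ex _ _ _ C′ _ _ _ _) = ⊥-elim (0≢1+n (IsC-unique C C′))
  IsD-unique (d-pos _ C _ _ _) (d-ax _ _ _ C′ _ _ _ _ _) = ⊥-elim (0≢1+n (IsC-unique C C′))
  IsD-unique (d-neg _ C _ _ _ _) (d-ex _ _ _ C′ _ _ _ _) = ⊥-elim (0≢1+n (IsC-unique C C′))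
  IsD-unique (d-neg _ C _ _ _ _) (d-ax _ _ _ C′ _ _ _ _ _) = ⊥-elim (0≢1+n (IsC-unique C C′))
  IsD-unique (d-ex _ _ _ C _ _ _ _) (d-pos _ C′ _ _ _) = ⊥-elim (0≢1+n (IsC-unique C′ C))
  IsD-unique (d-ax _ _ _ C _ _ _ _ _) (d-pos _ C′ _ _ _) = ⊥-elim (0≢1+n (IsC-unique C′ C))
  IsD-unique (d-ex _ _ _ C _ _ _ _) (d-neg _ C′ _ _ _ _) = ⊥-elim (0≢1+n (IsC-unique C′ C))
  IsD-unique (d-ax _ _ _ C _ _ _ _ _) (d-neg _ C′ _ _ _ _) = ⊥-elim (0≢1+n (IsC-unique C′ C))

  IsD-base : ∀ {q₁ q₂} → IsC K q₁ q₂ 0 → ∃ (IsD K q₁ q₂)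
  IsD-base {q₁} {q₂} C with least-counterexample (_∈? lab K q₁) (_∈? lab K q₂)
  ... | inj₂ (a , a∈ , a∉ , below) = atom a , d-pos a C a∈ a∉ below
  ... | inj₁ λ₁⊆λ₂ with least-counterexample (_∈? lab K q₂) (_∈? lab K q₁)
  ...   | inj₂ (a , a∈ , a∉ , below) = ¬ᶠ atom a , d-neg a C λ₁⊆λ₂ a∈ a∉ below
  ...   | inj₁ λ₂⊆λ₁ = ⊥-elim (proj₁ C (⊆-antisym (λ {a} → λ₁⊆λ₂ a) (λ {a} → λ₂⊆λ₁ a)))

  IsD-step : ∀ {c q₁ q₂} → IsC K q₁ q₂ (suc c) →
    (∀ {x y} → ¬ Sim K c x y → ∃ (IsD K x y)) → ∃ (IsD K q₁ q₂)
  IsD-step {c} {q₁} {q₂} C D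
    with least-counterexample (_∈? δ K q₁) (MatchedIn? (Sim? c) q₂)
  ... | inj₂ (a , a∈ , unmatched , below) =
    let a≁ = ¬MatchedIn⁻ (Sim K c) unmatched
        (f , f-spec) = decidable-choice tt (_∈? δ K q₂) (λ y y∈ → D (a≁ y y∈))
    in _ , d-ex c a f C a∈ a≁ below f-spec
  ... | inj₁ forth with least-counterexample (_∈? δ K q₂) (MatchedIn? (flip (Sim? c)) q₁)
  ...   | inj₂ (a , a∈ , unmatched , below) =
    let a≁ = ¬MatchedIn⁻ (flip (Sim K c)) unmatched
        (f , f-spec) = decidable-choice tt (_∈? δ K q₁) (λ x x∈ → D (a≁ x x∈ ∘ Sim-sym c))
    in _ , d-ax c a f C forth a∈ a≁ below f-spec
  ...   | inj₁ back = ⊥-elim (proj₁ C (proj₂ C c (n<1+n c) , forth , back))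

  IsD-exists : ∀ k {q₁ q₂} → ¬ Sim K k q₁ q₂ → ∃ (IsD K q₁ q₂)
  IsD-exists zero q₁≁q₂ = IsD-base (IsC-zero q₁≁q₂)
  IsD-exists (suc k) {q₁} {q₂} q₁≁q₂ with Sim? k q₁ q₂
  ... | no q₁≁′q₂ = IsD-exists k q₁≁′q₂
  ... | yes q₁∼q₂ = IsD-step (IsC-suc q₁∼q₂ q₁≁q₂) (IsD-exists k)

  SepFormula-consistent : ∀ (D : Fin n → Fin n → Formula m) {S⁺ S⁻} →
    (∀ p q → p ∈ S⁺ → q ∈ S⁻ → Distinguishes (D p q) p q) →
    Consistent K (SepFormula D S⁺ S⁻) S⁺ S⁻
  SepFormula-consistent D distinguishes =
    (λ p p∈ → ⊨-⋁-elems⁺ _ p∈ (⊨-⋀-elems⁺ (D p) (λ q q∈ → proj₁ (distinguishes p q p∈ q∈)))) ,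
    λ q q∈ sat → let (p , p∈ , sat-p) = ⊨-⋁-elems⁻ _ sat
                 in proj₂ (distinguishes p q p∈ q∈) (⊨-⋀-elems⁻ (D p) sat-p q∈)

  IsD-family : ∀ {S⁺ S⁻} → IsSample K S⁺ S⁻ →
    Σ (Fin n → Fin n → Formula m) λ D → ∀ p q → p ∈ S⁺ → q ∈ S⁻ → IsD K p q (D p q)
  IsD-family {S⁺} {S⁻} sample =
    let (k , k-bisimilar) = Sim-eventually-Bisimilar
        (D , D-spec) = decidable-choice tt (λ (p , q) → (p ∈? S⁺) ×-dec (q ∈? S⁻))
          (λ (p , q) (p∈ , q∈) → IsD-exists k (sample p q p∈ q∈ ∘ k-bisimilar p q))
    in curry D , λ p q p∈ q∈ → D-spec (p , q) (p∈ , q∈)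

theorem5 : ∀ {n m} (K : Kripke n m) (S⁺ S⁻ : Subset n) → IsSample K S⁺ S⁻ →
    -- well-definedness: each D_{q⁺,q⁻} exists ...
    (Σ (Fin n → Fin n → Formula m) λ D →
       ∀ q⁺ q⁻ → q⁺ ∈ S⁺ → q⁻ ∈ S⁻ → IsD K q⁺ q⁻ (D q⁺ q⁻))
    -- ... and is uniquely determined
    × (∀ q⁺ q⁻ → q⁺ ∈ S⁺ → q⁻ ∈ S⁻ → ∀ φ ψ →
         IsD K q⁺ q⁻ φ → IsD K q⁺ q⁻ ψ → φ ≡ ψ)
    -- consistency of S_K(S⁺,S⁻)
    × (∀ (D : Fin n → Fin n → Formula m) →
         (∀ q⁺ q⁻ → q⁺ ∈ S⁺ → q⁻ ∈ S⁻ → IsD K q⁺ q⁻ (D q⁺ q⁻)) →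
         Consistent K (SepFormula D S⁺ S⁻) S⁺ S⁻)
theorem5 K S⁺ S⁻ sample =
  IsD-family K sample ,
  (λ _ _ _ _ _ _ → IsD-unique K) ,
  λ D isD → SepFormula-consistent K D (λ p q p∈ q∈ → IsD-sound K (isD p q p∈ q∈))
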